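{- Let $G$ be a graph and let $\kappa>1$. Suppose that, for every $v\in V(G)$, there is a $\kappa$-decreasing function for $T_{\mathrm{saw}}(v,G)$. Then $\Delta(G)\le\kappa^2+1$.
   Context: $\Delta(G)$ is the maximum degree of $G$. The self-avoiding walk tree $T_{\mathrm{saw}}(v,G)$ is the rooted tree whose vertices are the simple paths in $G$ starting at $v$, with root the trivial path $v$, and in which the children of a path $P$ are the simple paths extending $P$ by one edge. For a rooted tree $T=(V,E,r)$, $C(x)$ denotes the set of children of $x$. For $\kappa\ge1$, a function $\theta:V\to\mathbb{R}$ is $\kappa$-decreasing for $T$ if $1/\kappa\le\theta(x)\le1$ for every $x\in V$ and $\sum_{y\in C(x)}\theta(y)\le\kappa\,\theta(x)$ for every $x\in V\setminus\{r\}$. -}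

module Defs where

open import Level using (Level)
open import Data.Nat as ℕ using (ℕ; zero; _⊔_)
  renaming (suc to sucℕ)
open import Data.Bool using (Bool; true; false; _∧_; not)
import Data.Bool
open import Data.Fin using (Fin)
open import Data.Fin.Properties using (_≟_)
open import Data.List using (List; []; _∷_; _++_; [_]; foldr; filterᵇ; length; map)
open import Data.List.Base using (allFin)
open import Data.Product using (_×_)
open import Relation.Nullary using (¬_)
open import Relation.Nullary.Decidable using (⌊_⌋)
open import Relation.Binary.PropositionalEquality using (_≡_)
open import Algebra.Structures using (IsCommutativeRing)
open import Relation.Binary.Structures using (IsTotalOrder)

-- Ordered fields (the paper works over ℝ; the standard library has no
-- reals, so the statement is made for an arbitrary ordered field, of
-- which ℝ is an instance).

record OrderedField (c ℓ : Level) : Set (Level.suc (c Level.⊔ ℓ)) where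
  infixl 7 _*_
  infixl 6 _+_
  infix  4 _≤_
  field
    Carrier : Set c
    _+_ _*_ : Carrier → Carrier → Carrier
    -_      : Carrier → Carrier
    0# 1#   : Carrier
    _⁻¹     : Carrier → Carrier
    _≤_     : Carrier → Carrier → Set ℓ
    isCommutativeRing : IsCommutativeRing _≡_ _+_ _*_ -_ 0# 1#
    isTotalOrder      : IsTotalOrder _≡_ _≤_
    0≢1     : ¬ (0# ≡ 1#)
    ⁻¹-inverse : ∀ x → ¬ (x ≡ 0#) → x * (x ⁻¹) ≡ 1#
    +-mono-≤   : ∀ x y z → x ≤ y → x + z ≤ y + z
    *-nonneg   : ∀ x y → 0# ≤ x → 0# ≤ y → 0# ≤ x * y

  _<_ : Carrier → Carrier → Set (c Level.⊔ ℓ)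
  x < y = (x ≤ y) × ¬ (x ≡ y)

  fromℕ : ℕ → Carrier
  fromℕ zero     = 0#
  fromℕ (sucℕ n) = 1# + fromℕ n

  sumF : List Carrier → Carrier
  sumF = foldr _+_ 0#

record Graph (n : ℕ) : Set where
  field
    adj       : Fin n → Fin n → Bool
    adj-sym   : ∀ x y → adj x y ≡ adj y x
    adj-irref : ∀ x → adj x x ≡ false

module _ {n : ℕ} (G : Graph n) where
  open Graph G

  vertices : List (Fin n)
  vertices = allFin n

  degree : Fin n → ℕ
  degree v = length (filterᵇ (adj v) vertices)

  maxDegree : ℕ
  maxDegree = foldr (λ v m → degree v ⊔ m) 0 vertices

  elem : Fin n → List (Fin n) → Bool
  elem x []       = false
  elem x (y ∷ ys) = ⌊ x ≟ y ⌋ Data.Bool.∨ elem x ys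

  distinct : List (Fin n) → Bool
  distinct []       = true
  distinct (x ∷ xs) = not (elem x xs) ∧ distinct xs

  chain : Fin n → List (Fin n) → Bool
  chain x []       = true
  chain x (y ∷ ys) = adj x y ∧ chain y ys

  -- A node of T_saw(v,G): the simple path  v , w₁ , … , wₖ  in G,
  -- represented by its tail  ws = w₁ ∷ … ∷ wₖ ∷ [].  The root is [].
  IsSAW : Fin n → List (Fin n) → Bool
  IsSAW v ws = chain v ws ∧ distinct (v ∷ ws)

  -- Children of the node ws in T_saw(v,G): the simple paths ws ++ [ w ]
  -- extending it by one edge.  Distinct w give distinct children.
  children : Fin n → List (Fin n) → List (List (Fin n))
  children v ws = filterᵇ (IsSAW v) (map (λ w → ws ++ [ w ]) vertices)

  -- θ is κ-decreasing for T_saw(v,G).  θ is given on all lists; only its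
  -- values on nodes (simple paths from v) matter.
  module _ {c ℓ} (F : OrderedField c ℓ) where
    open OrderedField F

    IsKappaDecreasing : Carrier → Fin n → (List (Fin n) → Carrier) → Set ℓ
    IsKappaDecreasing κ v θ =
      (∀ ws → IsSAW v ws ≡ true → (κ ⁻¹ ≤ θ ws) × (θ ws ≤ 1#))
      × (∀ ws → IsSAW v ws ≡ true → ¬ (ws ≡ []) →
           sumF (map θ (children v ws)) ≤ κ * θ ws)

-- Let u be a vertex with a neighbour w, and look at the node  w → u  of
-- T_saw(w,G).  Its children are the paths  w → u → x  for the neighbours
-- x ≠ w of u, so there are at least deg(u) − 1 of them.  Each child has
-- θ ≥ 1/κ, while κ-decreasingness bounds their sum by κ θ(w → u) ≤ κ.
-- Hence (deg(u) − 1)/κ ≤ κ, that is deg(u) ≤ κ² + 1.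
module Submission where

open import Defs
open import Level using (Level)
open import Data.Nat using (ℕ)
open import Data.Fin using (Fin)
open import Data.List using (List)
open import Data.Product using (Σ)

open import Algebra.Bundles using (CommutativeRing)
open import Algebra.Structures using (IsCommutativeRing)
import Algebra.Properties.Ring as RingProperties
open import Data.Bool using (Bool; true; false)
open import Data.Bool.Properties using (T-≡)
open import Data.Fin.Properties using (_≟_)
open import Data.List using ([]; _∷_; [_]; _++_; foldr; filterᵇ; length; map)
open import Data.List.Relation.Unary.All as All using (All; []; _∷_)
open import Data.List.Relation.Unary.All.Properties using (all-filter)
open import Data.List.Relation.Unary.AllPairs using ([]; _∷_)
open import Data.List.Relation.Unary.Unique.Propositional using (Unique)
open import Data.List.Relation.Unary.Unique.Propositional.Properties using (allFin⁺)
open import Data.Nat as ℕ using (zero; suc; _⊔_; z≤n; s≤s)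
open import Data.Nat.Properties using (m≤n⇒m≤1+n; ⊔-sel)
open import Data.Product using (_,_; proj₁; proj₂; ∃)
open import Data.Sum using (_⊎_; inj₁; inj₂)
open import Function.Base using (_∘_)
open import Function.Bundles using (Equivalence)
open import Relation.Binary.Bundles using (Poset)
import Relation.Binary.Reasoning.PartialOrder
open import Relation.Binary.Structures using (IsTotalOrder)
open import Relation.Binary.PropositionalEquality
  using (_≡_; refl; sym; trans; cong; subst; subst₂)
open import Relation.Nullary using (¬_; contradiction)
open import Relation.Nullary.Decidable using (⌊_⌋; T?; isYes≗does; dec-false; decidable-stable)

module _ {A B : Set} (p : A → Bool) (q : B → Bool) (f : A → B) (w : A)
         (lost⇒w : ∀ x → p x ≡ true → q (f x) ≡ false → x ≡ w) where

  length-filterᵇ-≤-map : ∀ {xs} → All (λ x → ¬ w ≡ x) xs →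
                         length (filterᵇ p xs) ℕ.≤ length (filterᵇ q (map f xs))
  length-filterᵇ-≤-map {[]}     []          = z≤n
  length-filterᵇ-≤-map {x ∷ xs} (w≢x ∷ w∉xs) with p x in px | q (f x) in qfx
  ... | true  | true  = s≤s (length-filterᵇ-≤-map w∉xs)
  ... | true  | false = contradiction (sym (lost⇒w x px qfx)) w≢x
  ... | false | true  = m≤n⇒m≤1+n (length-filterᵇ-≤-map w∉xs)
  ... | false | false = length-filterᵇ-≤-map w∉xs

  length-filterᵇ-≤-suc-map : ∀ {xs} → Unique xs →
                             length (filterᵇ p xs) ℕ.≤ suc (length (filterᵇ q (map f xs)))
  length-filterᵇ-≤-suc-map {[]}     []          = z≤n
  length-filterᵇ-≤-suc-map {x ∷ xs} (x∉xs ∷ uxs) with p x in px | q (f x) in qfx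
  ... | true  | true  = s≤s (length-filterᵇ-≤-suc-map uxs)
  ... | true  | false = s≤s (length-filterᵇ-≤-map w∉xs)
    where
    w∉xs : All (λ z → ¬ w ≡ z) xs
    w∉xs = subst (λ y → All (λ z → ¬ y ≡ z) xs) (lost⇒w x px qfx) x∉xs
  ... | false | true  = m≤n⇒m≤1+n (length-filterᵇ-≤-suc-map uxs)
  ... | false | false = length-filterᵇ-≤-suc-map uxs

length-filterᵇ≡0⊎∃ : ∀ {A : Set} (p : A → Bool) xs →
                     length (filterᵇ p xs) ≡ 0 ⊎ ∃ λ x → p x ≡ true
length-filterᵇ≡0⊎∃ p []       = inj₁ refl
length-filterᵇ≡0⊎∃ p (x ∷ xs) with p x in px
... | true  = inj₂ (x , px)
... | false = length-filterᵇ≡0⊎∃ p xs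

module OrderedFieldProperties {c ℓ : Level} (F : OrderedField c ℓ) where
  open OrderedField F renaming (+-mono-≤ to +-monoˡ-≤)
  open IsCommutativeRing isCommutativeRing
    using (+-comm; *-comm; *-assoc; distribʳ; zeroˡ;
           -‿inverseʳ; +-identityˡ; *-identityˡ; *-identityʳ)
  open IsTotalOrder isTotalOrder using (total; antisym; reflexive) renaming (trans to ≤-trans)
  commutativeRing : CommutativeRing c c
  commutativeRing = record { isCommutativeRing = isCommutativeRing }

  open RingProperties (CommutativeRing.ring commutativeRing)
    using (-‿involutive; -‿distribˡ-*; [y-z]x≈yx-zx; //-rightDividesˡ)

  poset : Poset c c ℓ
  poset = record { isPartialOrder = IsTotalOrder.isPartialOrder isTotalOrder }

  module ≤-Reasoning = Relation.Binary.Reasoning.PartialOrder poset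

  ≤-refl : ∀ {x} → x ≤ x
  ≤-refl = reflexive refl

  +-monoʳ-≤ : ∀ z {x y} → x ≤ y → z + x ≤ z + y
  +-monoʳ-≤ z {x} {y} x≤y = subst₂ _≤_ (+-comm x z) (+-comm y z) (+-monoˡ-≤ x y z x≤y)

  +-mono-≤ : ∀ {x y u v} → x ≤ y → u ≤ v → x + u ≤ y + v
  +-mono-≤ {x} {y} x≤y u≤v = ≤-trans (+-monoˡ-≤ x y _ x≤y) (+-monoʳ-≤ y u≤v)

  x≤y⇒0≤y-x : ∀ {x y} → x ≤ y → 0# ≤ y + - x
  x≤y⇒0≤y-x {x} {y} x≤y = subst (_≤ y + - x) (-‿inverseʳ x) (+-monoˡ-≤ x y (- x) x≤y)

  0≤y-x⇒x≤y : ∀ {x y} → 0# ≤ y + - x → x ≤ y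
  0≤y-x⇒x≤y {x} {y} 0≤y-x =
    subst₂ _≤_ (+-identityˡ x) (//-rightDividesˡ x y) (+-monoˡ-≤ 0# (y + - x) x 0≤y-x)

  *-monoˡ-≤-nonneg : ∀ z → 0# ≤ z → ∀ {x y} → x ≤ y → x * z ≤ y * z
  *-monoˡ-≤-nonneg z 0≤z {x} {y} x≤y =
    0≤y-x⇒x≤y (subst (0# ≤_) ([y-z]x≈yx-zx z y x) (*-nonneg _ z (x≤y⇒0≤y-x x≤y) 0≤z))

  *-monoʳ-≤-nonneg : ∀ z → 0# ≤ z → ∀ {x y} → x ≤ y → z * x ≤ z * y
  *-monoʳ-≤-nonneg z 0≤z {x} {y} x≤y =
    subst₂ _≤_ (*-comm x z) (*-comm y z) (*-monoˡ-≤-nonneg z 0≤z x≤y)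

  0≤1 : 0# ≤ 1#
  0≤1 with total 0# 1#
  ... | inj₁ 0≤1 = 0≤1
  ... | inj₂ 1≤0 = subst (0# ≤_) -1*-1≡1 (*-nonneg _ _ 0≤-1 0≤-1)
    where
    0≤-1 : 0# ≤ - 1#
    0≤-1 = subst₂ _≤_ (-‿inverseʳ 1#) (+-identityˡ (- 1#)) (+-monoˡ-≤ 1# 0# (- 1#) 1≤0)
    -1*-1≡1 : - 1# * - 1# ≡ 1#
    -1*-1≡1 = trans (sym (-‿distribˡ-* 1# (- 1#)))
                    (trans (cong -_ (*-identityˡ (- 1#))) (-‿involutive 1#))

  1<x⇒0<x : ∀ {x} → 1# < x → 0# < x
  1<x⇒0<x (1≤x , _) = ≤-trans 0≤1 1≤x , λ 0≡x → 0≢1 (antisym 0≤1 (subst (1# ≤_) (sym 0≡x) 1≤x))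

  fromℕ-nonneg : ∀ n → 0# ≤ fromℕ n
  fromℕ-nonneg zero    = ≤-refl
  fromℕ-nonneg (suc n) =
    subst (_≤ fromℕ (suc n)) (+-identityˡ 0#) (+-mono-≤ 0≤1 (fromℕ-nonneg n))

  fromℕ-mono-≤ : ∀ {m n} → m ℕ.≤ n → fromℕ m ≤ fromℕ n
  fromℕ-mono-≤ {n = n} z≤n = fromℕ-nonneg n
  fromℕ-mono-≤ (s≤s m≤n)   = +-monoʳ-≤ 1# (fromℕ-mono-≤ m≤n)

  fromℕ-foldr-⊔-≤ : ∀ {A : Set} (d : A → ℕ) {z} → 0# ≤ z →
                    (∀ x → fromℕ (d x) ≤ z) → ∀ xs → fromℕ (foldr (λ x m → d x ⊔ m) 0 xs) ≤ z
  fromℕ-foldr-⊔-≤ d 0≤z d≤z []       = 0≤z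
  fromℕ-foldr-⊔-≤ d 0≤z d≤z (x ∷ xs) with ⊔-sel (d x) (foldr (λ x m → d x ⊔ m) 0 xs)
  ... | inj₁ max≡dx rewrite max≡dx = d≤z x
  ... | inj₂ max≡rest rewrite max≡rest = fromℕ-foldr-⊔-≤ d 0≤z d≤z xs

  length*≤sumF : ∀ {A : Set} (θ : A → Carrier) {k xs} → All (λ x → k ≤ θ x) xs →
                 fromℕ (length xs) * k ≤ sumF (map θ xs)
  length*≤sumF θ {k} []                   = reflexive (zeroˡ k)
  length*≤sumF θ {k} {x ∷ xs} (k≤θx ∷ k≤θxs) = begin
    (1# + fromℕ (length xs)) * k         ≡⟨ distribʳ k 1# _ ⟩
    1# * k + fromℕ (length xs) * k       ≡⟨ cong (_+ fromℕ (length xs) * k) (*-identityˡ k) ⟩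
    k + fromℕ (length xs) * k            ≤⟨ +-mono-≤ k≤θx (length*≤sumF θ k≤θxs) ⟩
    θ x + sumF (map θ xs)                ∎
    where open ≤-Reasoning

⌊≟⌋-≢ : ∀ {n} {x y : Fin n} → ¬ x ≡ y → ⌊ x ≟ y ⌋ ≡ false
⌊≟⌋-≢ {x = x} {y} x≢y = trans (isYes≗does (x ≟ y)) (dec-false (x ≟ y) x≢y)

module _ {n : ℕ} (G : Graph n) where
  open Graph G

  adj⇒≢ : ∀ {x y} → adj x y ≡ true → ¬ x ≡ y
  adj⇒≢ {x} adj-xy refl = contradiction (trans (sym adj-xy) (adj-irref x)) λ ()

  IsSAW-edge : ∀ {w u} → adj w u ≡ true → IsSAW G w [ u ] ≡ true
  IsSAW-edge adj-wu rewrite adj-wu | ⌊≟⌋-≢ (adj⇒≢ adj-wu) = refl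

  IsSAW-path₂ : ∀ {w u x} → adj w u ≡ true → adj u x ≡ true → ¬ w ≡ x →
                IsSAW G w (u ∷ x ∷ []) ≡ true
  IsSAW-path₂ adj-wu adj-ux w≢x
    rewrite adj-wu | adj-ux | ⌊≟⌋-≢ (adj⇒≢ adj-wu) | ⌊≟⌋-≢ w≢x | ⌊≟⌋-≢ (adj⇒≢ adj-ux) = refl

  degree≤1+length-children : ∀ {w u} → adj w u ≡ true →
                             degree G u ℕ.≤ suc (length (children G w [ u ]))
  degree≤1+length-children {w} {u} adj-wu =
    length-filterᵇ-≤-suc-map (adj u) (IsSAW G w) (λ x → u ∷ x ∷ []) w lost⇒w (allFin⁺ n)
    where
    lost⇒w : ∀ x → adj u x ≡ true → IsSAW G w (u ∷ x ∷ []) ≡ false → x ≡ w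
    lost⇒w x adj-ux not-saw = decidable-stable (x ≟ w) λ x≢w →
      contradiction (trans (sym not-saw) (IsSAW-path₂ adj-wu adj-ux (x≢w ∘ sym))) λ ()

module _ {c ℓ : Level} (F : OrderedField c ℓ) (κ : OrderedField.Carrier F)
         (0<κ : OrderedField._<_ F (OrderedField.0# F) κ) where
  open OrderedField F hiding (+-mono-≤)
  open OrderedFieldProperties F
  open IsCommutativeRing isCommutativeRing using (+-comm; +-identityˡ; *-comm; *-assoc; *-identityʳ)
  open ≤-Reasoning

  0≤κ : 0# ≤ κ
  0≤κ = proj₁ 0<κ

  κ≢0 : ¬ κ ≡ 0#
  κ≢0 = proj₂ 0<κ ∘ sym

  0≤κ*κ+1 : 0# ≤ κ * κ + 1#
  0≤κ*κ+1 = subst (_≤ κ * κ + 1#) (+-identityˡ 0#) (+-mono-≤ (*-nonneg κ κ 0≤κ 0≤κ) 0≤1)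

  module _ {n : ℕ} (G : Graph n) {v : Fin n} {θ : List (Fin n) → Carrier}
           (θ-κ-decreasing : IsKappaDecreasing G F κ v θ) where

    κ⁻¹≤θ-children : ∀ ws → All (λ ys → κ ⁻¹ ≤ θ ys) (children G v ws)
    κ⁻¹≤θ-children ws =
      All.map (λ saw → proj₁ (proj₁ θ-κ-decreasing _ (Equivalence.to T-≡ saw)))
              (all-filter (T? ∘ IsSAW G v) (map (λ w → ws ++ [ w ]) (vertices G)))

    length-children≤κ*κ : ∀ {ws} → IsSAW G v ws ≡ true → ¬ ws ≡ [] →
                          fromℕ (length (children G v ws)) ≤ κ * κ
    length-children≤κ*κ {ws} saw ws≢[] = begin
      fromℕ m                         ≡⟨ sym m*κ⁻¹*κ≡m ⟩
      fromℕ m * κ ⁻¹ * κ              ≤⟨ *-monoˡ-≤-nonneg κ 0≤κ (length*≤sumF θ (κ⁻¹≤θ-children ws)) ⟩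
      sumF (map θ (children G v ws)) * κ
                                      ≤⟨ *-monoˡ-≤-nonneg κ 0≤κ sum≤κ ⟩
      κ * κ                           ∎
      where
      m : ℕ
      m = length (children G v ws)
      m*κ⁻¹*κ≡m : fromℕ m * κ ⁻¹ * κ ≡ fromℕ m
      m*κ⁻¹*κ≡m = trans (*-assoc _ _ _)
        (trans (cong (fromℕ m *_) (trans (*-comm (κ ⁻¹) κ) (⁻¹-inverse κ κ≢0))) (*-identityʳ _))
      sum≤κ : sumF (map θ (children G v ws)) ≤ κ
      sum≤κ = begin
        sumF (map θ (children G v ws)) ≤⟨ proj₂ θ-κ-decreasing ws saw ws≢[] ⟩
        κ * θ ws                       ≤⟨ *-monoʳ-≤-nonneg κ 0≤κ (proj₂ (proj₁ θ-κ-decreasing ws saw)) ⟩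
        κ * 1#                         ≡⟨ *-identityʳ κ ⟩
        κ                              ∎

  module _ {n : ℕ} (G : Graph n)
           (θ-exists : ∀ v → Σ (List (Fin n) → Carrier) (IsKappaDecreasing G F κ v)) where
    open Graph G

    degree≤κ*κ+1 : ∀ u → fromℕ (degree G u) ≤ κ * κ + 1#
    degree≤κ*κ+1 u with length-filterᵇ≡0⊎∃ (adj u) (vertices G)
    ... | inj₁ degree≡0 = subst (λ d → fromℕ d ≤ κ * κ + 1#) (sym degree≡0) 0≤κ*κ+1
    ... | inj₂ (w , adj-uw) = begin
      fromℕ (degree G u)                        ≤⟨ fromℕ-mono-≤ (degree≤1+length-children G adj-wu) ⟩
      1# + fromℕ (length (children G w [ u ]))  ≤⟨ +-monoʳ-≤ 1# length-children-wu≤κ*κ ⟩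
      1# + κ * κ                                ≡⟨ +-comm 1# (κ * κ) ⟩
      κ * κ + 1#                                ∎
      where
      adj-wu : adj w u ≡ true
      adj-wu = trans (adj-sym w u) adj-uw
      length-children-wu≤κ*κ : fromℕ (length (children G w [ u ])) ≤ κ * κ
      length-children-wu≤κ*κ =
        length-children≤κ*κ G (proj₂ (θ-exists w)) {[ u ]} (IsSAW-edge G adj-wu) λ ()

    maxDegree≤κ*κ+1 : fromℕ (maxDegree G) ≤ κ * κ + 1#
    maxDegree≤κ*κ+1 = fromℕ-foldr-⊔-≤ (degree G) 0≤κ*κ+1 degree≤κ*κ+1 (vertices G)

lemma24 : ∀ {c ℓ : Level} (F : OrderedField c ℓ) {n : ℕ} (G : Graph n)
    (κ : OrderedField.Carrier F) →
    OrderedField._<_ F (OrderedField.1# F) κ →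
    (∀ (v : Fin n) → Σ (List (Fin n) → OrderedField.Carrier F)
                        (λ θ → IsKappaDecreasing G F κ v θ)) →
    OrderedField._≤_ F (OrderedField.fromℕ F (maxDegree G))
      (OrderedField._+_ F (OrderedField._*_ F κ κ) (OrderedField.1# F))
lemma24 F G κ 1<κ θ-exists = maxDegree≤κ*κ+1 F κ (1<x⇒0<x 1<κ) G θ-exists
  where open OrderedFieldProperties F
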